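{- Let $g=2n$ with $n$ a positive integer, and let $q_1<q_2<\dots<q_k$ be the distinct prime factors of $g$. Then for every prime $p$, $$\sum_{j\ge1} w_{g,j}(p\#)=\prod_{i:\ 2<q_i\le p}\frac{q_i-1}{q_i-2}.$$
   Context: For a prime $p$, $p\#$ denotes the product of all primes $\le p$. For a positive integer $N$, let $1=u_0<\dots<u_{\varphi(N)}=N+1$ be the integers in $[1,N+1]$ coprime to $N$, and $\mathcal{G}(N)=(g_1,\dots,g_{\varphi(N)})$, $g_i=u_i-u_{i-1}$, indices cyclic mod $\varphi(N)$. For $j\ge1$, $n_{g,j}(N)$ is the number of positions $i\in\{1,\dots,\varphi(N)\}$ with $g_i+\dots+g_{i+j-1}=g$, and $w_{g,j}(N)=n_{g,j}(N)/n_{2,1}(N)$. -}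

module Defs where

open import Data.Nat using (ℕ; zero; suc; _+_; _*_; _∸_; _<_; _≟_)
open import Data.Nat.DivMod using (_%_)
open import Data.Nat.Primality using (Prime; prime?)
open import Data.Nat.Coprimality using (Coprime; coprime?)
open import Data.Nat.Divisibility using (_∣_; _∣?_)
open import Data.Nat.Properties using (_<?_)
open import Data.List using (List; []; _∷_; filter; length; upTo; map; zipWith)
open import Data.Nat.ListAction using (sum; product)
open import Data.Integer using (+_)
open import Data.Rational using (ℚ; _/_; 0ℚ; 1ℚ) renaming (_+_ to _+ℚ_; _*_ to _*ℚ_)
open import Relation.Nullary using (yes; no)
open import Relation.Nullary.Decidable using (_×-dec_)
open import Data.Product using (_×_)

range : ℕ → ℕ → List ℕ
range a b = map (λ t → a + t) (upTo (suc (b ∸ a)))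

primorial : ℕ → ℕ
primorial p = product (filter prime? (range 1 p))

-- 1 = u_0 < ... < u_φ = N+1 : integers in [1, N+1] coprime to N
coprimeList : ℕ → List ℕ
coprimeList N = filter (λ k → coprime? k N) (range 1 (suc N))

tail : List ℕ → List ℕ
tail [] = []
tail (_ ∷ xs) = xs

gaps : ℕ → List ℕ
gaps N = zipWith _∸_ (tail (coprimeList N)) (coprimeList N)

-- 0-based lookup with default 0
nth : List ℕ → ℕ → ℕ
nth [] _ = 0
nth (x ∷ xs) zero = x
nth (x ∷ xs) (suc i) = nth xs i

phiLen : ℕ → ℕ
phiLen N = length (gaps N)

-- g_{i+1} + ... + g_{i+j} with cyclic indices (0-based position i)
windowSum : (N i j : ℕ) → ℕ
windowSum N i j with phiLen N
... | zero = 0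
... | suc m = sum (map (λ t → nth (gaps N) ((i + t) % suc m)) (upTo j))

nCount : (g j N : ℕ) → ℕ
nCount g j N = length (filter (λ i → windowSum N i j ≟ g) (upTo (phiLen N)))

-- w_{g,j}(N) = n_{g,j}(N) / n_{2,1}(N)   (convention: 0 if n_{2,1}(N) = 0)
w : (g j N : ℕ) → ℚ
w g j N with nCount 2 1 N
... | zero = 0ℚ
... | suc d = (+ nCount g j N) / suc d

sumℚ : List ℚ → ℚ
sumℚ [] = 0ℚ
sumℚ (x ∷ xs) = x +ℚ sumℚ xs

prodℚ : List ℚ → ℚ
prodℚ [] = 1ℚ
prodℚ (x ∷ xs) = x *ℚ prodℚ xs

-- Σ_{j ≥ 1} w_{g,j}(N); terms with j > g vanish since every gap is ≥ 1,
-- so the sum is taken over 1 ≤ j ≤ g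
sumW : (g N : ℕ) → ℚ
sumW g N = sumℚ (map (λ j → w g j N) (range 1 g))

-- factor (q-1)/(q-2) if q is a prime divisor of g with q > 2, else 1
factor : (g q : ℕ) → ℚ
factor g q with prime? q ×-dec (q ∣? g) ×-dec (2 <? q)
factor g (suc (suc (suc r))) | yes _ = (+ (2 + r)) / (1 + r)
factor g _ | _ = 1ℚ

prodFactor : (g p : ℕ) → ℚ
prodFactor g p = prodℚ (map (factor g) (range 1 p))

{-# OPTIONS --safe #-}
-- Let N = p# and list the positive integers coprime to N increasingly as U 0 < U 1 < ⋯; this
-- sequence is periodic, U (k + φ(N)) = U k + N, and its differences are the cyclic gaps of N.
-- A window of j consecutive gaps starting at position i sums to g exactly when U (i + j) = U i + g,
-- so for fixed i exactly one length j ≤ g works if U i + g is coprime to N, and none otherwise.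
-- Hence Σ_j n_{g,j}(N) counts the residues r mod N with r and r + g both coprime to N, which by
-- the Chinese remainder theorem is the product over the primes q ≤ p of q − 1 if q ∣ g and q − 2
-- otherwise. As N is even every gap is at least 2, so n_{2,2}(N) = 0 and n_{2,1}(N) is the same
-- count for g = 2; the quotient of the two products is the claimed one.
module Submission where

open import Defs
open import Data.Empty using (⊥-elim)
open import Data.Integer as ℤ using (+_)
import Data.Integer.Properties as ℤ
open import Data.List using (List; []; _∷_; _++_; [_]; filter; length; map; upTo; applyUpTo; zipWith)
open import Data.List.Properties using (upTo-∷ʳ; map-++; filter-++; filter-accept; filter-reject; length-++; map-upTo; map-∘; map-cong)
open import Data.List.Membership.Propositional using (_∈_)
open import Data.List.Membership.Propositional.Properties using (∈-filter⁺; ∈-filter⁻; ∈-map⁺; ∈-upTo⁺)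
open import Data.List.Relation.Unary.All.Properties using (all-filter)
open import Data.List.Relation.Unary.Any using (here; there)
open import Data.List.Relation.Unary.Linked using (Linked; [-]; _∷_)
open import Data.List.Relation.Unary.Linked.Properties using (applyUpTo⁺₂; filter⁺)
open import Data.Nat as ℕ using (ℕ; zero; suc; _+_; _*_; _∸_; _≤_; _<_; z≤n; s≤s; z<s; _≟_; NonZero; nonTrivial⇒n>1; >-nonZero⁻¹)
open import Data.Nat.Coprimality as Coprimality using (Coprime; coprime?; coprime-+; coprime-divisor; coprime-Bézout)
open import Data.Nat.Divisibility
open import Data.Nat.DivMod using (_%_; _div_; m≡m%n+[m/n]*n; m%n<n; m<n⇒m%n≡m; [m+n]%n≡m%n)
open import Data.Nat.GCD using (module Bézout)
open import Data.Nat.ListAction using (sum; product)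
open import Data.Nat.ListAction.Properties using (sum-++; product-++; ∈⇒∣product)
open import Data.Nat.Primality using (Prime; prime?; prime[2]; ¬prime[0]; ¬prime[1]; euclidsLemma; prime⇒irreducible; prime⇒nonTrivial; productOfPrimes≢0)
open import Data.Nat.Properties
open import Data.Nat.Solver using (module +-*-Solver)
open import Data.Product using (Σ-syntax; _×_; _,_; proj₁; proj₂)
open import Data.Rational using (ℚ; _/_; 1ℚ; toℚᵘ) renaming (_+_ to _+ℚ_; _*_ to _*ℚ_)
open import Data.Rational.Properties as ℚ using (toℚᵘ-injective; toℚᵘ-fromℚᵘ; toℚᵘ-homo-+; toℚᵘ-homo-*; 0/n≡0; /-cong)
import Data.Rational.Unnormalised as ℚᵘ
import Data.Rational.Unnormalised.Properties as ℚᵘ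
open import Data.Sum using (_⊎_; inj₁; inj₂)
open import Relation.Binary.Definitions using (tri<; tri≈; tri>)
open import Relation.Binary.PropositionalEquality hiding ([_])
open import Relation.Nullary using (Dec; yes; no; ¬_; ¬?; _×-dec_)
open import Relation.Unary using (Decidable)
open +-*-Solver

-- Finite sums and counting

∑< : ℕ → (ℕ → ℕ) → ℕ
∑< zero    f = 0
∑< (suc n) f = ∑< n f + f n

infix 5 ∑<
syntax ∑< n (λ t → e) = ∑[ t < n ] e

𝟙 : ∀ {P : Set} → Dec P → ℕ
𝟙 (yes _) = 1
𝟙 (no _)  = 0

module _ {P Q : Set} where

  𝟙-cong : (p : Dec P) (q : Dec Q) → (P → Q) → (Q → P) → 𝟙 p ≡ 𝟙 q
  𝟙-cong (yes _) (yes _) _ _ = refl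
  𝟙-cong (yes p) (no ¬q) f _ = ⊥-elim (¬q (f p))
  𝟙-cong (no ¬p) (yes q) _ g = ⊥-elim (¬p (g q))
  𝟙-cong (no _)  (no _)  _ _ = refl

  𝟙-* : (p : Dec P) (q : Dec Q) → 𝟙 p * 𝟙 q ≡ 𝟙 (p ×-dec q)
  𝟙-* (yes _) (yes _) = refl
  𝟙-* (yes _) (no _)  = refl
  𝟙-* (no _)  _       = refl

  𝟙-inclusion-exclusion : (p : Dec P) (q : Dec Q) → 𝟙 (¬? p) * 𝟙 (¬? q) + 𝟙 p + 𝟙 q ≡ 1 + 𝟙 p * 𝟙 q
  𝟙-inclusion-exclusion (yes _) (yes _) = refl
  𝟙-inclusion-exclusion (yes _) (no _)  = refl
  𝟙-inclusion-exclusion (no _)  (yes _) = refl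
  𝟙-inclusion-exclusion (no _)  (no _)  = refl

∑-cong : ∀ n {f h} → (∀ t → t < n → f t ≡ h t) → ∑< n f ≡ ∑< n h
∑-cong zero    e = refl
∑-cong (suc n) e = cong₂ _+_ (∑-cong n (λ t t<n → e t (m<n⇒m<1+n t<n))) (e n ≤-refl)

∑-zero : ∀ n {f} → (∀ t → t < n → f t ≡ 0) → ∑< n f ≡ 0
∑-zero zero    e = refl
∑-zero (suc n) e = cong₂ _+_ (∑-zero n (λ t t<n → e t (m<n⇒m<1+n t<n))) (e n ≤-refl)

∑-1 : ∀ n → ∑[ t < n ] 1 ≡ n
∑-1 zero    = refl
∑-1 (suc n) = trans (cong (_+ 1) (∑-1 n)) (+-comm n 1)

∑-+ : ∀ n f h → ∑[ t < n ] (f t + h t) ≡ ∑< n f + ∑< n h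
∑-+ zero    f h = refl
∑-+ (suc n) f h = trans (cong (_+ (f n + h n)) (∑-+ n f h))
  (solve 4 (λ a b c d → a :+ b :+ (c :+ d) := a :+ c :+ (b :+ d)) refl (∑< n f) (∑< n h) (f n) (h n))

∑-*ʳ : ∀ n f c → ∑[ t < n ] (f t * c) ≡ ∑< n f * c
∑-*ʳ zero    f c = refl
∑-*ʳ (suc n) f c = trans (cong (_+ f n * c) (∑-*ʳ n f c)) (sym (*-distribʳ-+ c (∑< n f) (f n)))

∑-comm : ∀ a b (f : ℕ → ℕ → ℕ) → ∑[ i < a ] ∑[ j < b ] f i j ≡ ∑[ j < b ] ∑[ i < a ] f i j
∑-comm zero    b f = sym (∑-zero b (λ _ _ → refl))
∑-comm (suc a) b f = begin
  (∑[ i < a ] ∑[ j < b ] f i j) + (∑[ j < b ] f a j) ≡⟨ cong (_+ (∑[ j < b ] f a j)) (∑-comm a b f) ⟩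
  (∑[ j < b ] ∑[ i < a ] f i j) + (∑[ j < b ] f a j) ≡⟨ ∑-+ b (λ j → ∑[ i < a ] f i j) (λ j → f a j) ⟨
  ∑[ j < b ] ((∑[ i < a ] f i j) + f a j)            ∎
  where open ≡-Reasoning

∑-split : ∀ a b f → ∑< (a + b) f ≡ ∑< a f + (∑[ t < b ] f (a + t))
∑-split a zero    f = trans (cong (λ n → ∑< n f) (+-identityʳ a)) (sym (+-identityʳ _))
∑-split a (suc b) f = begin
  ∑< (a + suc b) f                              ≡⟨ cong (λ n → ∑< n f) (+-suc a b) ⟩
  ∑< (a + b) f + f (a + b)                      ≡⟨ cong (_+ f (a + b)) (∑-split a b f) ⟩
  ∑< a f + (∑[ t < b ] f (a + t)) + f (a + b)   ≡⟨ +-assoc (∑< a f) _ _ ⟩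
  ∑< a f + ((∑[ t < b ] f (a + t)) + f (a + b)) ∎
  where open ≡-Reasoning

∑-blocks : ∀ M q f → ∑< (M * q) f ≡ ∑[ k < q ] ∑[ r < M ] f (M * k + r)
∑-blocks M zero    f = cong (λ n → ∑< n f) (*-zeroʳ M)
∑-blocks M (suc q) f = begin
  ∑< (M * suc q) f                                                   ≡⟨ cong (λ n → ∑< n f) (trans (*-suc M q) (+-comm M (M * q))) ⟩
  ∑< (M * q + M) f                                                   ≡⟨ ∑-split (M * q) M f ⟩
  ∑< (M * q) f + (∑[ r < M ] f (M * q + r))                          ≡⟨ cong (_+ (∑[ r < M ] f (M * q + r))) (∑-blocks M q f) ⟩
  (∑[ k < q ] ∑[ r < M ] f (M * k + r)) + (∑[ r < M ] f (M * q + r)) ∎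
  where open ≡-Reasoning

∑-shift : ∀ n f → (∑[ t < n ] f (suc t)) + f 0 ≡ ∑< n f + f n
∑-shift zero    f = refl
∑-shift (suc n) f = trans (solve 3 (λ a b c → a :+ b :+ c := a :+ c :+ b) refl (∑[ t < n ] f (suc t)) (f (suc n)) (f 0))
                          (cong (_+ f (suc n)) (∑-shift n f))

module _ {P : ℕ → Set} (P? : Decidable P) where

  count-none : ∀ n → (∀ t → ¬ P t) → ∑[ t < n ] 𝟙 (P? t) ≡ 0
  count-none n ¬P = ∑-zero n λ t _ → 𝟙-no t
    where
    𝟙-no : ∀ t → 𝟙 (P? t) ≡ 0
    𝟙-no t with P? t
    ... | yes Pt = ⊥-elim (¬P t Pt)
    ... | no _   = refl

  count-unique : ∀ n t₀ → t₀ < n → P t₀ → (∀ t → t < n → P t → t ≡ t₀) → ∑[ t < n ] 𝟙 (P? t) ≡ 1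
  count-unique zero    t₀ () _ _
  count-unique (suc n) t₀ t₀<1+n Pt₀ unique with P? n
  ... | yes Pn with unique n ≤-refl Pn
  ...   | refl = cong (_+ 1) (∑-zero n λ t t<n → 𝟙-no t t<n)
    where
    𝟙-no : ∀ t → t < n → 𝟙 (P? t) ≡ 0
    𝟙-no t t<n with P? t
    ... | yes Pt = ⊥-elim (<-irrefl (unique t (m<n⇒m<1+n t<n) Pt) t<n)
    ... | no _   = refl
  count-unique (suc n) t₀ t₀<1+n Pt₀ unique | no ¬Pn with m≤n⇒m<n∨m≡n (≤-pred t₀<1+n)
  ... | inj₁ t₀<n = trans (+-identityʳ _) (count-unique n t₀ t₀<n Pt₀ (λ t t<n → unique t (m<n⇒m<1+n t<n)))
  ... | inj₂ refl = ⊥-elim (¬Pn Pt₀)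

sum-map-upTo : ∀ f n → sum (map f (upTo n)) ≡ ∑< n f
sum-map-upTo f zero    = refl
sum-map-upTo f (suc n) = begin
  sum (map f (upTo (suc n)))       ≡⟨ cong (λ xs → sum (map f xs)) (upTo-∷ʳ n) ⟨
  sum (map f (upTo n ++ [ n ]))    ≡⟨ cong sum (map-++ f (upTo n) [ n ]) ⟩
  sum (map f (upTo n) ++ [ f n ])  ≡⟨ sum-++ (map f (upTo n)) [ f n ] ⟩
  sum (map f (upTo n)) + (f n + 0) ≡⟨ cong₂ _+_ (sum-map-upTo f n) (+-identityʳ (f n)) ⟩
  ∑< n f + f n                     ∎
  where open ≡-Reasoning

length-filter : ∀ {P : ℕ → Set} (P? : Decidable P) xs → length (filter P? xs) ≡ sum (map (λ x → 𝟙 (P? x)) xs)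
length-filter P? []       = refl
length-filter P? (x ∷ xs) with P? x
... | yes _ = cong suc (length-filter P? xs)
... | no _  = length-filter P? xs

length-filter-upTo : ∀ {P : ℕ → Set} (P? : Decidable P) n → length (filter P? (upTo n)) ≡ ∑[ t < n ] 𝟙 (P? t)
length-filter-upTo P? n = trans (length-filter P? (upTo n)) (sum-map-upTo (λ t → 𝟙 (P? t)) n)

-- Coprime residue pairs modulo a primorial

coprime-*+⁺ : ∀ x M k → Coprime x M → Coprime (M * k + x) M
coprime-*+⁺ x M k c (d∣M*k+x , d∣M) = c (∣m+n∣m⇒∣n d∣M*k+x (∣m⇒∣m*n k d∣M) , d∣M)

coprime-*+⁻ : ∀ x M k → Coprime (M * k + x) M → Coprime x M
coprime-*+⁻ x M k c (d∣x , d∣M) = c (∣m∣n⇒∣m+n (∣m⇒∣m*n k d∣M) d∣x , d∣M)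

𝟙-coprime-*+ : ∀ x M k → 𝟙 (coprime? (M * k + x) M) ≡ 𝟙 (coprime? x M)
𝟙-coprime-*+ x M k = 𝟙-cong _ _ (coprime-*+⁻ x M k) (coprime-*+⁺ x M k)

prime∤⇒coprime : ∀ {q d} → Prime q → ¬ q ∣ d → Coprime q d
prime∤⇒coprime pq q∤d (e∣q , e∣d) with prime⇒irreducible pq e∣q
... | inj₁ e≡1 = e≡1
... | inj₂ refl = ⊥-elim (q∤d e∣d)

module _ {x M q : ℕ} (pq : Prime q) where

  coprime-*prime⇒coprime∧∤ : Coprime x (M * q) → Coprime x M × ¬ q ∣ x
  coprime-*prime⇒coprime∧∤ c = (λ (d∣x , d∣M) → c (d∣x , ∣m⇒∣m*n q d∣M))
                             , (λ q∣x → ¬prime[1] (subst Prime (c (q∣x , n∣m*n M)) pq))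

  coprime∧∤⇒coprime-*prime : Coprime x M × ¬ q ∣ x → Coprime x (M * q)
  coprime∧∤⇒coprime-*prime (c , q∤x) {d} (d∣x , d∣M*q) = c (d∣x , d∣M)
    where
    d∣M : d ∣ M
    d∣M = coprime-divisor (Coprimality.sym (prime∤⇒coprime pq (λ q∣d → q∤x (∣-trans q∣d d∣x))))
                          (subst (d ∣_) (*-comm M q) d∣M*q)

  𝟙-coprime-*prime : 𝟙 (coprime? x (M * q)) ≡ 𝟙 (coprime? x M) * 𝟙 (¬? (q ∣? x))
  𝟙-coprime-*prime = trans (𝟙-cong (coprime? x (M * q)) (coprime? x M ×-dec ¬? (q ∣? x))
                                   coprime-*prime⇒coprime∧∤ coprime∧∤⇒coprime-*prime)
                           (sym (𝟙-* (coprime? x M) (¬? (q ∣? x))))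

localFactor : ℕ → ℕ → ℕ
localFactor q g = q ∸ 2 + 𝟙 (q ∣? g)

coprimePairCount : ℕ → ℕ → ℕ
coprimePairCount N g = ∑[ r < N ] 𝟙 (coprime? r N) * 𝟙 (coprime? (r + g) N)

module ResiduesModPrime (q₁ M : ℕ) (pq : Prime (suc q₁)) (q∤M : ¬ suc q₁ ∣ M) where

  private
    q = suc q₁

  divisible-% : ∀ k s → q ∣ M * k + s → q ∣ M * (k % q) + s
  divisible-% k s q∣ = ∣m+n∣m⇒∣n (subst (q ∣_) split q∣) (∣n⇒∣m*n M (n∣m*n (k div q)))
    where
    split : M * k + s ≡ M * ((k div q) * q) + (M * (k % q) + s)
    split = begin
      M * k + s                               ≡⟨ cong (λ z → M * z + s) (m≡m%n+[m/n]*n k q) ⟩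
      M * (k % q + (k div q) * q) + s         ≡⟨ solve 4 (λ M a b s → M :* (a :+ b) :+ s := M :* b :+ (M :* a :+ s)) refl M (k % q) ((k div q) * q) s ⟩
      M * ((k div q) * q) + (M * (k % q) + s) ∎
      where open ≡-Reasoning

  divisible-exists : ∀ s → Σ[ k ∈ ℕ ] k < q × q ∣ M * k + s
  -- Bézout gives y with y M ≡ −1 or y M ≡ 1 (mod q); then k ≡ ∓ y s, written y s (q − 1) in the second case.
  divisible-exists s with coprime-Bézout (prime∤⇒coprime pq q∤M)
  ... | Bézout.+- x y eq = (y * s) % q , m%n<n (y * s) q , divisible-% (y * s) s (divides (s * x) e)
    where
    e : M * (y * s) + s ≡ s * x * q
    e = begin
      M * (y * s) + s ≡⟨ solve 3 (λ M y s → M :* (y :* s) :+ s := s :* (con 1 :+ y :* M)) refl M y s ⟩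
      s * (1 + y * M) ≡⟨ cong (s *_) eq ⟩
      s * (x * q)     ≡⟨ *-assoc s x q ⟨
      s * x * q       ∎
      where open ≡-Reasoning
  ... | Bézout.-+ x y eq = (y * s * q₁) % q , m%n<n (y * s * q₁) q , divisible-% (y * s * q₁) s (divides (s + x * s * q₁) e)
    where
    e : M * (y * s * q₁) + s ≡ (s + x * s * q₁) * q
    e = begin
      M * (y * s * q₁) + s       ≡⟨ solve 4 (λ M y s q₁ → M :* (y :* s :* q₁) :+ s := (y :* M) :* (s :* q₁) :+ s) refl M y s q₁ ⟩
      (y * M) * (s * q₁) + s     ≡⟨ cong (λ z → z * (s * q₁) + s) eq ⟨
      (1 + x * q) * (s * q₁) + s ≡⟨ solve 3 (λ x s q₁ → (con 1 :+ x :* (con 1 :+ q₁)) :* (s :* q₁) :+ s := (s :+ x :* s :* q₁) :* (con 1 :+ q₁)) refl x s q₁ ⟩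
      (s + x * s * q₁) * q       ∎
      where open ≡-Reasoning

  private
    divisible-unique≤ : ∀ s {k k′} → k ≤ k′ → k′ < q → q ∣ M * k + s → q ∣ M * k′ + s → k ≡ k′
    divisible-unique≤ s {k} k≤k′ k′<q q∣ q∣′ with m≤n⇒∃[o]m+o≡n k≤k′
    ... | zero  , refl = sym (+-identityʳ k)
    ... | suc δ , refl = ⊥-elim (<⇒≱ (≤-<-trans (m≤n+m (suc δ) k) k′<q) (∣⇒≤ q∣δ))
      where
      rearrange : M * (k + suc δ) + s ≡ (M * k + s) + M * suc δ
      rearrange = solve 4 (λ M k d s → M :* (k :+ d) :+ s := (M :* k :+ s) :+ M :* d) refl M k (suc δ) s
      q∣δ : q ∣ suc δ
      q∣δ = coprime-divisor (prime∤⇒coprime pq q∤M) (∣m+n∣m⇒∣n (subst (q ∣_) rearrange q∣′) q∣)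

  divisible-unique : ∀ s k k′ → k < q → k′ < q → q ∣ M * k + s → q ∣ M * k′ + s → k ≡ k′
  divisible-unique s k k′ k<q k′<q q∣ q∣′ with ≤-total k k′
  ... | inj₁ k≤k′ = divisible-unique≤ s k≤k′ k′<q q∣ q∣′
  ... | inj₂ k′≤k = sym (divisible-unique≤ s k′≤k k<q q∣′ q∣)

  divisible-count : ∀ s → ∑[ k < q ] 𝟙 (q ∣? M * k + s) ≡ 1
  divisible-count s with divisible-exists s
  ... | k₀ , k₀<q , q∣ = count-unique (λ k → q ∣? M * k + s) q k₀ k₀<q q∣
                           (λ k k<q q∣′ → divisible-unique s k k₀ k<q k₀<q q∣′ q∣)

  bothDivisible-count : ∀ r g → ∑[ k < q ] 𝟙 (q ∣? M * k + r) * 𝟙 (q ∣? M * k + (r + g)) ≡ 𝟙 (q ∣? g)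
  bothDivisible-count r g = trans (∑-cong q (λ k _ → 𝟙-* (q ∣? M * k + r) _)) (by-cases (q ∣? g))
    where
    both : (k : ℕ) → Dec (q ∣ M * k + r × q ∣ M * k + (r + g))
    both k = (q ∣? M * k + r) ×-dec (q ∣? M * k + (r + g))
    by-cases : (q∣?g : Dec (q ∣ g)) → ∑[ k < q ] 𝟙 (both k) ≡ 𝟙 q∣?g
    by-cases (yes q∣g) = trans (∑-cong q (λ k _ → 𝟙-cong (both k) (q ∣? M * k + r) proj₁ (λ q∣x → q∣x , shift q∣x)))
                               (divisible-count r)
      where
      shift : ∀ {k} → q ∣ M * k + r → q ∣ M * k + (r + g)
      shift {k} q∣x = subst (q ∣_) (+-assoc (M * k) r g) (∣m∣n⇒∣m+n q∣x q∣g)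
    by-cases (no q∤g) = count-none both q (λ k (q∣x , q∣y) → q∤g (∣m+n∣m⇒∣n (subst (q ∣_) (sym (+-assoc (M * k) r g)) q∣y) q∣x))

  bothIndivisible-count : ∀ r g → ∑[ k < q ] 𝟙 (¬? (q ∣? M * k + r)) * 𝟙 (¬? (q ∣? M * k + (r + g))) ≡ localFactor q g
  bothIndivisible-count r g = begin
    X               ≡⟨ m+n∸n≡m X 2 ⟨
    X + 2 ∸ 2       ≡⟨ cong (_∸ 2) (+-assoc X 1 1) ⟨
    X + 1 + 1 ∸ 2   ≡⟨ cong (_∸ 2) complement ⟩
    q + Y ∸ 2       ≡⟨ +-∸-comm Y (nonTrivial⇒n>1 q {{prime⇒nonTrivial pq}}) ⟩
    q ∸ 2 + Y       ≡⟨ cong (_+_ (q ∸ 2)) (bothDivisible-count r g) ⟩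
    localFactor q g ∎
    where
    open ≡-Reasoning
    A B : ℕ → ℕ
    A k = 𝟙 (q ∣? M * k + r)
    B k = 𝟙 (q ∣? M * k + (r + g))
    X = ∑[ k < q ] 𝟙 (¬? (q ∣? M * k + r)) * 𝟙 (¬? (q ∣? M * k + (r + g)))
    Y = ∑[ k < q ] A k * B k
    complement : X + 1 + 1 ≡ q + Y
    complement = begin
      X + 1 + 1                       ≡⟨ cong₂ (λ a b → X + a + b) (divisible-count r) (divisible-count (r + g)) ⟨
      X + ∑< q A + ∑< q B             ≡⟨ cong (_+ ∑< q B) (∑-+ q _ A) ⟨
      (∑[ k < q ] (_ + A k)) + ∑< q B ≡⟨ ∑-+ q _ B ⟨
      ∑[ k < q ] (_ + A k + B k)      ≡⟨ ∑-cong q (λ k _ → 𝟙-inclusion-exclusion (q ∣? M * k + r) (q ∣? M * k + (r + g))) ⟩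
      ∑[ k < q ] (1 + A k * B k)      ≡⟨ ∑-+ q (λ _ → 1) _ ⟩
      (∑[ k < q ] 1) + Y              ≡⟨ cong (_+ Y) (∑-1 q) ⟩
      q + Y                           ∎

  coprimePairCount-*prime : ∀ g → coprimePairCount (M * q) g ≡ coprimePairCount M g * localFactor q g
  coprimePairCount-*prime g = begin
    ∑< (M * q) f                           ≡⟨ ∑-blocks M q f ⟩
    ∑[ k < q ] ∑[ r < M ] f (M * k + r)    ≡⟨ ∑-cong q (λ k _ → ∑-cong M (λ r _ → f-block k r)) ⟩
    ∑[ k < q ] ∑[ r < M ] (a k r * c r)    ≡⟨ ∑-comm q M (λ k r → a k r * c r) ⟩
    ∑[ r < M ] ∑[ k < q ] (a k r * c r)    ≡⟨ ∑-cong M (λ r _ → ∑-*ʳ q (λ k → a k r) (c r)) ⟩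
    ∑[ r < M ] ((∑[ k < q ] a k r) * c r)  ≡⟨ ∑-cong M (λ r _ → trans (cong (_* c r) (bothIndivisible-count r g)) (*-comm (localFactor q g) (c r))) ⟩
    ∑[ r < M ] (c r * localFactor q g)     ≡⟨ ∑-*ʳ M c (localFactor q g) ⟩
    coprimePairCount M g * localFactor q g ∎
    where
    open ≡-Reasoning
    f : ℕ → ℕ
    f x = 𝟙 (coprime? x (M * q)) * 𝟙 (coprime? (x + g) (M * q))
    a : ℕ → ℕ → ℕ
    a k r = 𝟙 (¬? (q ∣? M * k + r)) * 𝟙 (¬? (q ∣? M * k + (r + g)))
    c : ℕ → ℕ
    c r = 𝟙 (coprime? r M) * 𝟙 (coprime? (r + g) M)
    f-block : ∀ k r → f (M * k + r) ≡ a k r * c r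
    f-block k r = begin
      f (M * k + r)
        ≡⟨ cong₂ _*_ (𝟙-coprime-*prime {M * k + r} {M} pq)
                     (trans (cong (λ z → 𝟙 (coprime? z (M * q))) (+-assoc (M * k) r g)) (𝟙-coprime-*prime {M * k + (r + g)} {M} pq)) ⟩
      (𝟙 (coprime? (M * k + r) M) * α) * (𝟙 (coprime? (M * k + (r + g)) M) * β)
        ≡⟨ cong₂ (λ u v → (u * α) * (v * β)) (𝟙-coprime-*+ r M k) (𝟙-coprime-*+ (r + g) M k) ⟩
      (𝟙 (coprime? r M) * α) * (𝟙 (coprime? (r + g) M) * β)
        ≡⟨ solve 4 (λ w x y z → (w :* x) :* (y :* z) := (x :* z) :* (w :* y)) refl (𝟙 (coprime? r M)) α (𝟙 (coprime? (r + g) M)) β ⟩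
      a k r * c r ∎
      where
      α = 𝟙 (¬? (q ∣? M * k + r))
      β = 𝟙 (¬? (q ∣? M * k + (r + g)))

sieveProduct : ℕ → ℕ → ℕ
sieveProduct g zero = 1
sieveProduct g (suc m) with prime? (suc m)
... | yes _ = sieveProduct g m * localFactor (suc m) g
... | no _  = sieveProduct g m

sieveProduct-suc-prime : ∀ g m → Prime (suc m) → sieveProduct g (suc m) ≡ sieveProduct g m * localFactor (suc m) g
sieveProduct-suc-prime g m p with prime? (suc m)
... | yes _ = refl
... | no ¬p = ⊥-elim (¬p p)

sieveProduct-suc-¬prime : ∀ g m → ¬ Prime (suc m) → sieveProduct g (suc m) ≡ sieveProduct g m
sieveProduct-suc-¬prime g m ¬p with prime? (suc m)
... | yes p = ⊥-elim (¬p p)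
... | no _  = refl

localFactor-2-nonZero : ∀ {q} → Prime q → NonZero (localFactor q 2)
localFactor-2-nonZero {0}                   p = ⊥-elim (¬prime[0] p)
localFactor-2-nonZero {1}                   p = ⊥-elim (¬prime[1] p)
localFactor-2-nonZero {2}                   _ = _
localFactor-2-nonZero {suc (suc (suc r))}   _ = _

sieveProduct-2-nonZero : ∀ m → NonZero (sieveProduct 2 m)
sieveProduct-2-nonZero zero    = _
sieveProduct-2-nonZero (suc m) with prime? (suc m)
... | yes p = m*n≢0 (sieveProduct 2 m) (localFactor (suc m) 2) {{sieveProduct-2-nonZero m}} {{localFactor-2-nonZero p}}
... | no _  = sieveProduct-2-nonZero m

primorial-upTo : ∀ m → primorial m ≡ product (filter prime? (map suc (upTo m)))
primorial-upTo zero    = refl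
primorial-upTo (suc m) = refl

private
  primorial-suc : ∀ m → primorial (suc m) ≡ primorial m * product (filter prime? [ suc m ])
  primorial-suc m = begin
    product (filter prime? (map suc (upTo (suc m))))                               ≡⟨ cong (λ xs → product (filter prime? (map suc xs))) (upTo-∷ʳ m) ⟨
    product (filter prime? (map suc (upTo m ++ [ m ])))                            ≡⟨ cong (λ xs → product (filter prime? xs)) (map-++ suc (upTo m) [ m ]) ⟩
    product (filter prime? (map suc (upTo m) ++ [ suc m ]))                        ≡⟨ cong product (filter-++ prime? (map suc (upTo m)) [ suc m ]) ⟩
    product (filter prime? (map suc (upTo m)) ++ filter prime? [ suc m ])          ≡⟨ product-++ (filter prime? (map suc (upTo m))) _ ⟩
    product (filter prime? (map suc (upTo m))) * product (filter prime? [ suc m ]) ≡⟨ cong (_* product (filter prime? [ suc m ])) (primorial-upTo m) ⟨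
    primorial m * product (filter prime? [ suc m ])                                ∎
    where open ≡-Reasoning

primorial-suc-prime : ∀ m → Prime (suc m) → primorial (suc m) ≡ primorial m * suc m
primorial-suc-prime m p = begin
  primorial (suc m)                               ≡⟨ primorial-suc m ⟩
  primorial m * product (filter prime? [ suc m ]) ≡⟨ cong (λ xs → primorial m * product xs) (filter-accept prime? p) ⟩
  primorial m * (suc m * 1)                       ≡⟨ cong (primorial m *_) (*-identityʳ (suc m)) ⟩
  primorial m * suc m                             ∎
  where open ≡-Reasoning

primorial-suc-¬prime : ∀ m → ¬ Prime (suc m) → primorial (suc m) ≡ primorial m
primorial-suc-¬prime m ¬p = begin
  primorial (suc m)                               ≡⟨ primorial-suc m ⟩
  primorial m * product (filter prime? [ suc m ]) ≡⟨ cong (λ xs → primorial m * product xs) (filter-reject prime? ¬p) ⟩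
  primorial m * 1                                 ≡⟨ *-identityʳ (primorial m) ⟩
  primorial m                                     ∎
  where open ≡-Reasoning

prime∣primorial⇒≤ : ∀ {q} m → Prime q → q ∣ primorial m → q ≤ m
prime∣primorial⇒≤ zero pq q∣1 = ⊥-elim (¬prime[1] (subst Prime (∣1⇒≡1 q∣1) pq))
prime∣primorial⇒≤ (suc m) pq q∣ with prime? (suc m)
... | no ¬p = m≤n⇒m≤1+n (prime∣primorial⇒≤ m pq (subst (_ ∣_) (primorial-suc-¬prime m ¬p) q∣))
... | yes p with euclidsLemma (primorial m) (suc m) pq (subst (_ ∣_) (primorial-suc-prime m p) q∣)
...   | inj₁ q∣primorial = m≤n⇒m≤1+n (prime∣primorial⇒≤ m pq q∣primorial)
...   | inj₂ q∣1+m       = ∣⇒≤ q∣1+m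

coprimePairCount-1 : ∀ g → coprimePairCount 1 g ≡ 1
coprimePairCount-1 g = cong₂ _*_ (𝟙-coprime-1 0) (𝟙-coprime-1 g)
  where
  𝟙-coprime-1 : ∀ x → 𝟙 (coprime? x 1) ≡ 1
  𝟙-coprime-1 x with coprime? x 1
  ... | yes _  = refl
  ... | no ¬c = ⊥-elim (¬c (Coprimality.sym (Coprimality.1-coprimeTo x)))

coprimePairCount-primorial : ∀ g m → coprimePairCount (primorial m) g ≡ sieveProduct g m
coprimePairCount-primorial g zero = coprimePairCount-1 g
coprimePairCount-primorial g (suc m) with prime? (suc m)
... | no ¬p = trans (cong (λ N → coprimePairCount N g) (primorial-suc-¬prime m ¬p)) (coprimePairCount-primorial g m)
... | yes p = begin
  coprimePairCount (primorial (suc m)) g                   ≡⟨ cong (λ N → coprimePairCount N g) (primorial-suc-prime m p) ⟩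
  coprimePairCount (primorial m * suc m) g                 ≡⟨ ResiduesModPrime.coprimePairCount-*prime m (primorial m) p q∤primorial g ⟩
  coprimePairCount (primorial m) g * localFactor (suc m) g ≡⟨ cong (_* localFactor (suc m) g) (coprimePairCount-primorial g m) ⟩
  sieveProduct g m * localFactor (suc m) g                 ∎
  where
  open ≡-Reasoning
  q∤primorial : ¬ suc m ∣ primorial m
  q∤primorial q∣ = <-irrefl refl (prime∣primorial⇒≤ m p q∣)

primorial-nonZero : ∀ m → NonZero (primorial m)
primorial-nonZero m = productOfPrimes≢0 (all-filter prime? (range 1 m))

2∣primorial : ∀ {p} → Prime p → 2 ∣ primorial p
2∣primorial {suc p′} pp = ∈⇒∣product (∈-filter⁺ prime? (∈-map⁺ (λ t → 1 + t) (∈-upTo⁺ 1<p)) prime[2])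
  where
  1<p : 1 < suc p′
  1<p = nonTrivial⇒n>1 (suc p′) {{prime⇒nonTrivial pp}}

-- The gap sequence

module CoprimeEnumeration
  (N φ : ℕ) .{{_ : NonZero N}} {{_ : NonZero φ}} (u G : ℕ → ℕ)
  (u-first      : u 0 ≡ 1)
  (u-last       : u φ ≡ suc N)
  (u-increasing : ∀ r → r < φ → u r < u (suc r))
  (G-gap        : ∀ r → r < φ → G r ≡ u (suc r) ∸ u r)
  (u-coprime    : ∀ r → r < φ → Coprime (u r) N)
  (u-complete   : ∀ x → 1 ≤ x → x ≤ N → Coprime x N → Σ[ r ∈ ℕ ] r < φ × u r ≡ x)
  where

  -- The periodic continuation of u: U k is the k-th positive integer coprime to N, counting from 0.
  U : ℕ → ℕ
  U zero    = 1
  U (suc k) = U k + G (k % φ)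

  U-<-suc : ∀ k → U k < U (suc k)
  U-<-suc k = subst (_≤ U k + G (k % φ)) (+-comm (U k) 1) (+-monoʳ-≤ (U k) G≥1)
    where
    G≥1 : 1 ≤ G (k % φ)
    G≥1 = subst (1 ≤_) (sym (G-gap (k % φ) (m%n<n k φ))) (m<n⇒0<n∸m (u-increasing (k % φ) (m%n<n k φ)))

  U-+-≤ : ∀ k m → U k + m ≤ U (k + m)
  U-+-≤ k zero    = ≤-reflexive (trans (+-identityʳ (U k)) (cong U (sym (+-identityʳ k))))
  U-+-≤ k (suc m) = begin
    U k + suc m     ≡⟨ +-suc (U k) m ⟩
    suc (U k + m)   ≤⟨ s≤s (U-+-≤ k m) ⟩
    suc (U (k + m)) ≤⟨ U-<-suc (k + m) ⟩
    U (suc (k + m)) ≡⟨ cong U (+-suc k m) ⟨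
    U (k + suc m)   ∎
    where open ≤-Reasoning

  U-strictMono : ∀ {a b} → a < b → U a < U b
  U-strictMono {a} a<b with m≤n⇒∃[o]m+o≡n a<b
  ... | o , refl = <-≤-trans (U-<-suc a) (≤-trans (m≤m+n (U (suc a)) o) (U-+-≤ (suc a) o))

  U-injective : ∀ {a b} → U a ≡ U b → a ≡ b
  U-injective {a} {b} e with <-cmp a b
  ... | tri< a<b _ _ = ⊥-elim (<-irrefl e (U-strictMono a<b))
  ... | tri≈ _ a≡b _ = a≡b
  ... | tri> _ _ b<a = ⊥-elim (<-irrefl (sym e) (U-strictMono b<a))

  U-<-reflect : ∀ {a b} → U a < U b → a < b
  U-<-reflect {a} {b} Ua<Ub with <-cmp a b
  ... | tri< a<b _ _ = a<b
  ... | tri≈ _ refl _ = ⊥-elim (<-irrefl refl Ua<Ub)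
  ... | tri> _ _ b<a = ⊥-elim (<-asym Ua<Ub (U-strictMono b<a))

  U≡u : ∀ r → r ≤ φ → U r ≡ u r
  U≡u zero    _   = sym u-first
  U≡u (suc r) r<φ = begin
    U r + G (r % φ)         ≡⟨ cong₂ _+_ (U≡u r (<⇒≤ r<φ)) (cong G (m<n⇒m%n≡m r<φ)) ⟩
    u r + G r               ≡⟨ cong (_+_ (u r)) (G-gap r r<φ) ⟩
    u r + (u (suc r) ∸ u r) ≡⟨ m+[n∸m]≡n (<⇒≤ (u-increasing r r<φ)) ⟩
    u (suc r)               ∎
    where open ≡-Reasoning

  U-periodic : ∀ k → U (k + φ) ≡ U k + N
  U-periodic zero    = trans (U≡u φ ≤-refl) u-last
  U-periodic (suc k) = begin
    U (k + φ) + G ((k + φ) % φ) ≡⟨ cong₂ _+_ (U-periodic k) (cong G ([m+n]%n≡m%n k φ)) ⟩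
    U k + N + G (k % φ)         ≡⟨ solve 3 (λ a b c → a :+ b :+ c := a :+ c :+ b) refl (U k) N (G (k % φ)) ⟩
    U k + G (k % φ) + N         ∎
    where open ≡-Reasoning

  U-+-* : ∀ r t → r < φ → U (r + t * φ) ≡ u r + t * N
  U-+-* r zero    r<φ = trans (cong U (+-identityʳ r)) (trans (U≡u r (<⇒≤ r<φ)) (sym (+-identityʳ (u r))))
  U-+-* r (suc t) r<φ = begin
    U (r + (φ + t * φ)) ≡⟨ cong U (solve 3 (λ r p q → r :+ (p :+ q) := r :+ q :+ p) refl r φ (t * φ)) ⟩
    U (r + t * φ + φ)   ≡⟨ U-periodic (r + t * φ) ⟩
    U (r + t * φ) + N   ≡⟨ cong (_+ N) (U-+-* r t r<φ) ⟩
    u r + t * N + N     ≡⟨ solve 3 (λ a b c → a :+ b :+ c := a :+ (c :+ b)) refl (u r) (t * N) N ⟩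
    u r + (N + t * N)   ∎
    where open ≡-Reasoning

  U-coprime : ∀ k → Coprime (U k) N
  U-coprime k = subst (λ z → Coprime z N) (sym U-divMod) (coprime-*+⁺ (u (k % φ)) N (k div φ) (u-coprime (k % φ) (m%n<n k φ)))
    where
    U-divMod : U k ≡ N * (k div φ) + u (k % φ)
    U-divMod = begin
      U k                       ≡⟨ cong U (m≡m%n+[m/n]*n k φ) ⟩
      U (k % φ + (k div φ) * φ) ≡⟨ U-+-* (k % φ) (k div φ) (m%n<n k φ) ⟩
      u (k % φ) + (k div φ) * N ≡⟨ solve 3 (λ a b c → a :+ b :* c := c :* b :+ a) refl (u (k % φ)) (k div φ) N ⟩
      N * (k div φ) + u (k % φ) ∎
      where open ≡-Reasoning

  U-surjective : ∀ x → 1 ≤ x → Coprime x N → Σ[ k ∈ ℕ ] U k ≡ x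
  U-surjective (suc y) _ c = r + (y div N) * φ , (begin
    U (r + (y div N) * φ) ≡⟨ U-+-* r (y div N) r<φ ⟩
    u r + (y div N) * N   ≡⟨ cong (_+ (y div N) * N) ur≡s ⟩
    s + (y div N) * N     ≡⟨ x≡ ⟨
    suc y                 ∎)
    where
    open ≡-Reasoning
    s = suc (y % N)
    x≡ : suc y ≡ s + (y div N) * N
    x≡ = cong suc (m≡m%n+[m/n]*n y N)
    s-coprime : Coprime s N
    s-coprime = coprime-*+⁻ s N (y div N)
      (subst (λ z → Coprime z N) (trans x≡ (solve 3 (λ a b c → a :+ b :* c := c :* b :+ a) refl s (y div N) N)) c)
    complete = u-complete s (s≤s z≤n) (m%n<n y N) s-coprime
    r = proj₁ complete
    r<φ = proj₁ (proj₂ complete)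
    ur≡s = proj₂ (proj₂ complete)

  windowSum-telescopes : ∀ i j → ∑[ t < j ] G ((i + t) % φ) ≡ U (i + j) ∸ U i
  windowSum-telescopes i j = trans (sym (m+n∸n≡m _ (U i))) (cong (_∸ U i) (telescope j))
    where
    telescope : ∀ j → (∑[ t < j ] G ((i + t) % φ)) + U i ≡ U (i + j)
    telescope zero    = cong U (sym (+-identityʳ i))
    telescope (suc j) = begin
      (∑[ t < j ] G ((i + t) % φ)) + G ((i + j) % φ) + U i ≡⟨ solve 3 (λ a b c → a :+ b :+ c := a :+ c :+ b) refl (∑[ t < j ] G ((i + t) % φ)) (G ((i + j) % φ)) (U i) ⟩
      (∑[ t < j ] G ((i + t) % φ)) + U i + G ((i + j) % φ) ≡⟨ cong (_+ G ((i + j) % φ)) (telescope j) ⟩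
      U (suc (i + j))                                      ≡⟨ cong U (+-suc i j) ⟨
      U (i + suc j)                                        ∎
      where open ≡-Reasoning

  U-window-end : ∀ i j {w} → U (i + suc j) ∸ U i ≡ w → U (i + suc j) ≡ U i + w
  U-window-end i j e = trans (sym (m+[n∸m]≡n (<⇒≤ (U-strictMono (m<m+n i z<s))))) (cong (_+_ (U i)) e)

  windowCount : ∀ i g .{{_ : NonZero g}} → i < φ → ∑[ j < g ] 𝟙 (U (i + suc j) ∸ U i ≟ g) ≡ 𝟙 (coprime? (u i + g) N)
  windowCount i g i<φ with coprime? (u i + g) N
  ... | no ¬c = count-none (λ j → U (i + suc j) ∸ U i ≟ g) g
                  (λ j e → ¬c (subst (λ z → Coprime z N) (trans (U-window-end i j e) (cong (_+ g) (U≡u i (<⇒≤ i<φ))))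
                                     (U-coprime (i + suc j))))
  ... | yes c = count-unique (λ j → U (i + suc j) ∸ U i ≟ g) g j₀ j₀<g window₀ unique
    where
    hit = U-surjective (u i + g) (≤-trans (>-nonZero⁻¹ g) (m≤n+m g (u i))) c
    k = proj₁ hit
    Uk≡ : U k ≡ U i + g
    Uk≡ = trans (proj₂ hit) (cong (_+ g) (sym (U≡u i (<⇒≤ i<φ))))
    i<k : i < k
    i<k = U-<-reflect (subst (U i <_) (sym Uk≡) (m<m+n (U i) (>-nonZero⁻¹ g)))
    j₀ = proj₁ (m≤n⇒∃[o]m+o≡n i<k)
    i+1+j₀≡k : i + suc j₀ ≡ k
    i+1+j₀≡k = trans (+-suc i j₀) (proj₂ (m≤n⇒∃[o]m+o≡n i<k))
    j₀<g : j₀ < g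
    j₀<g = +-cancelˡ-≤ (U i) (suc j₀) g (≤-trans (U-+-≤ i (suc j₀)) (≤-reflexive (trans (cong U i+1+j₀≡k) Uk≡)))
    window₀ : U (i + suc j₀) ∸ U i ≡ g
    window₀ = trans (cong (λ z → U z ∸ U i) i+1+j₀≡k) (trans (cong (_∸ U i) Uk≡) (m+n∸m≡n (U i) g))
    unique : ∀ j → j < g → U (i + suc j) ∸ U i ≡ g → j ≡ j₀
    unique j _ e = suc-injective (+-cancelˡ-≡ i (suc j) (suc j₀)
                     (U-injective (trans (U-window-end i j e) (trans (sym Uk≡) (cong U (sym i+1+j₀≡k))))))

  module _ (2∣N : 2 ∣ N) where

    private
      2∣n⊎2∣1+n : ∀ n → 2 ∣ n ⊎ 2 ∣ suc n
      2∣n⊎2∣1+n zero    = inj₁ (divides 0 refl)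
      2∣n⊎2∣1+n (suc n) with 2∣n⊎2∣1+n n
      ... | inj₁ 2∣n   = inj₂ (∣m∣n⇒∣m+n {m = 2} ∣-refl 2∣n)
      ... | inj₂ 2∣1+n = inj₁ 2∣1+n

      U-odd : ∀ k → ¬ 2 ∣ U k
      U-odd k 2∣Uk with U-coprime k (2∣Uk , 2∣N)
      ... | ()

    U-gap≥2 : ∀ k → U k + 2 ≤ U (suc k)
    U-gap≥2 k with m≤n⇒m<n∨m≡n (U-<-suc k)
    ... | inj₁ 1+Uk<U[1+k] = subst (_≤ U (suc k)) (+-comm 2 (U k)) 1+Uk<U[1+k]
    ... | inj₂ 1+Uk≡U[1+k] with 2∣n⊎2∣1+n (U k)
    ...   | inj₁ 2∣Uk   = ⊥-elim (U-odd k 2∣Uk)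
    ...   | inj₂ 2∣1+Uk = ⊥-elim (U-odd (suc k) (subst (2 ∣_) 1+Uk≡U[1+k] 2∣1+Uk))

    window₂≢2 : ∀ i → U (i + 2) ∸ U i ≢ 2
    window₂≢2 i e = <⇒≱ (s≤s (s≤s (s≤s z≤n))) (+-cancelˡ-≤ (U i) 4 2 (begin
      U i + 4         ≡⟨ +-assoc (U i) 2 2 ⟨
      U i + 2 + 2     ≤⟨ +-monoˡ-≤ 2 (U-gap≥2 i) ⟩
      U (suc i) + 2   ≤⟨ U-gap≥2 (suc i) ⟩
      U (suc (suc i)) ≡⟨ cong U (+-comm 2 i) ⟩
      U (i + 2)       ≡⟨ U-window-end i 1 e ⟩
      U i + 2         ∎))
      where open ≤-Reasoning

nth-++ˡ : ∀ xs ys {i} → i < length xs → nth (xs ++ ys) i ≡ nth xs i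
nth-++ˡ (x ∷ xs) ys {zero}  _         = refl
nth-++ˡ (x ∷ xs) ys {suc i} (s≤s i<n) = nth-++ˡ xs ys i<n

nth-length : ∀ xs z → nth (xs ++ [ z ]) (length xs) ≡ z
nth-length []       z = refl
nth-length (x ∷ xs) z = nth-length xs z

nth∈ : ∀ xs {i} → i < length xs → nth xs i ∈ xs
nth∈ (x ∷ xs) {zero}  _         = here refl
nth∈ (x ∷ xs) {suc i} (s≤s i<n) = there (nth∈ xs i<n)

∈⇒nth : ∀ {x} xs → x ∈ xs → Σ[ i ∈ ℕ ] i < length xs × nth xs i ≡ x
∈⇒nth (y ∷ xs) (here refl) = 0 , s≤s z≤n , refl
∈⇒nth (y ∷ xs) (there x∈xs) with ∈⇒nth xs x∈xs
... | i , i<n , e = suc i , s≤s i<n , e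

nth-linked : ∀ {R : ℕ → ℕ → Set} xs {i} → Linked R xs → suc i < length xs → R (nth xs i) (nth xs (suc i))
nth-linked (x ∷ y ∷ xs) {zero}  (r ∷ _)  _          = r
nth-linked (x ∷ y ∷ xs) {suc i} (_ ∷ rs) (s≤s i<n)  = nth-linked (y ∷ xs) rs i<n
nth-linked (x ∷ [])     {i}     [-]      (s≤s ())

length-zipWith-tail : ∀ (f : ℕ → ℕ → ℕ) x ys → length (zipWith f ys (x ∷ ys)) ≡ length ys
length-zipWith-tail f x []       = refl
length-zipWith-tail f x (y ∷ ys) = cong suc (length-zipWith-tail f y ys)

nth-zipWith-tail : ∀ (f : ℕ → ℕ → ℕ) x ys {r} → r < length ys → nth (zipWith f ys (x ∷ ys)) r ≡ f (nth ys r) (nth (x ∷ ys) r)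
nth-zipWith-tail f x (y ∷ ys) {zero}  _         = refl
nth-zipWith-tail f x (y ∷ ys) {suc r} (s≤s r<n) = nth-zipWith-tail f y ys r<n

∑-nth : ∀ (h : ℕ → ℕ) xs → ∑[ i < length xs ] h (nth xs i) ≡ sum (map h xs)
∑-nth h []       = refl
∑-nth h (x ∷ xs) = begin
  ∑[ i < suc (length xs) ] h (nth (x ∷ xs) i) ≡⟨ ∑-shift (length xs) (λ i → h (nth (x ∷ xs) i)) ⟨
  (∑[ i < length xs ] h (nth xs i)) + h x     ≡⟨ cong (_+ h x) (∑-nth h xs) ⟩
  sum (map h xs) + h x                        ≡⟨ +-comm (sum (map h xs)) (h x) ⟩
  h x + sum (map h xs)                        ∎
  where open ≡-Reasoning

sum-map-filter : ∀ {P : ℕ → Set} (P? : Decidable P) (h : ℕ → ℕ) xs →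
                 sum (map h (filter P? xs)) ≡ sum (map (λ x → 𝟙 (P? x) * h x) xs)
sum-map-filter P? h []       = refl
sum-map-filter P? h (x ∷ xs) with P? x
... | yes _ = cong₂ _+_ (sym (+-identityʳ (h x))) (sum-map-filter P? h xs)
... | no _  = sum-map-filter P? h xs

module GapSequence (N₀ : ℕ) where

  private
    N = suc N₀

    coprimeTo? : Decidable (λ x → Coprime x N)
    coprimeTo? x = coprime? x N

    inner : List ℕ
    inner = filter coprimeTo? (map suc (applyUpTo suc N₀))

    φ′ : ℕ
    φ′ = length inner

    coprimeTo-1+N : Coprime (suc N) N
    coprimeTo-1+N = subst (λ x → Coprime x N) (+-comm N 1) (coprime-+ (Coprimality.1-coprimeTo N))

    coprimeList-≤N : filter coprimeTo? (map suc (upTo N)) ≡ 1 ∷ inner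
    coprimeList-≤N = filter-accept coprimeTo? (Coprimality.1-coprimeTo N)

    coprimeList≡ : coprimeList N ≡ 1 ∷ inner ++ [ suc N ]
    coprimeList≡ = begin
      filter coprimeTo? (map suc (upTo (suc N)))                          ≡⟨ cong (λ xs → filter coprimeTo? (map suc xs)) (upTo-∷ʳ N) ⟨
      filter coprimeTo? (map suc (upTo N ++ [ N ]))                       ≡⟨ cong (filter coprimeTo?) (map-++ suc (upTo N) [ N ]) ⟩
      filter coprimeTo? (map suc (upTo N) ++ [ suc N ])                   ≡⟨ filter-++ coprimeTo? (map suc (upTo N)) [ suc N ] ⟩
      filter coprimeTo? (map suc (upTo N)) ++ filter coprimeTo? [ suc N ] ≡⟨ cong₂ _++_ coprimeList-≤N (filter-accept coprimeTo? coprimeTo-1+N) ⟩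
      1 ∷ inner ++ [ suc N ]                                              ∎
      where open ≡-Reasoning

    gaps≡ : gaps N ≡ zipWith _∸_ (inner ++ [ suc N ]) (1 ∷ inner ++ [ suc N ])
    gaps≡ = cong (λ xs → zipWith _∸_ (tail xs) xs) coprimeList≡

    length-inner+1 : length (inner ++ [ suc N ]) ≡ suc φ′
    length-inner+1 = trans (length-++ inner) (+-comm φ′ 1)

    phiLen≡ : phiLen N ≡ suc φ′
    phiLen≡ = trans (cong length gaps≡) (trans (length-zipWith-tail _∸_ 1 (inner ++ [ suc N ])) length-inner+1)

    u : ℕ → ℕ
    u = nth (coprimeList N)

    G : ℕ → ℕ
    G = nth (gaps N)

    u≡ : ∀ r → u r ≡ nth (1 ∷ inner ++ [ suc N ]) r
    u≡ r = cong (λ xs → nth xs r) coprimeList≡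

    <φ⇒<length : ∀ {r} → r < suc φ′ → r < length (inner ++ [ suc N ])
    <φ⇒<length {r} = subst (r <_) (sym length-inner+1)

    u-last : u (suc φ′) ≡ suc N
    u-last = trans (u≡ (suc φ′)) (nth-length (1 ∷ inner) (suc N))

    u-increasing : ∀ r → r < suc φ′ → u r < u (suc r)
    u-increasing r r<φ = subst (λ xs → nth xs r < nth xs (suc r)) (sym coprimeList≡)
      (nth-linked (1 ∷ inner ++ [ suc N ]) (subst (Linked _<_) coprimeList≡ sorted) (s≤s (<φ⇒<length r<φ)))
      where
      sorted : Linked _<_ (coprimeList N)
      sorted = filter⁺ coprimeTo? <-trans
                 (subst (Linked _<_) (sym (map-upTo suc (suc N))) (applyUpTo⁺₂ suc (suc N) (λ _ → ≤-refl)))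

    G-gap : ∀ r → r < suc φ′ → G r ≡ u (suc r) ∸ u r
    G-gap r r<φ = begin
      G r                                                               ≡⟨ cong (λ xs → nth xs r) gaps≡ ⟩
      nth (zipWith _∸_ (inner ++ [ suc N ]) (1 ∷ inner ++ [ suc N ])) r ≡⟨ nth-zipWith-tail _∸_ 1 (inner ++ [ suc N ]) (<φ⇒<length r<φ) ⟩
      nth (inner ++ [ suc N ]) r ∸ nth (1 ∷ inner ++ [ suc N ]) r       ≡⟨ cong₂ _∸_ (u≡ (suc r)) (u≡ r) ⟨
      u (suc r) ∸ u r                                                   ∎
      where open ≡-Reasoning

    u-coprime : ∀ r → r < suc φ′ → Coprime (u r) N
    u-coprime r r<φ = proj₂ (∈-filter⁻ coprimeTo? {xs = map suc (upTo (suc N))}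
                              (nth∈ (coprimeList N) (subst (λ xs → r < length xs) (sym coprimeList≡) (m<n⇒m<1+n (<φ⇒<length r<φ)))))

    u-complete : ∀ x → 1 ≤ x → x ≤ N → Coprime x N → Σ[ r ∈ ℕ ] r < suc φ′ × u r ≡ x
    u-complete (suc y) _ y<N c = r , r<φ , trans (u≡ r) (trans (nth-++ˡ (1 ∷ inner) [ suc N ] r<φ) ur≡x)
      where
      position = ∈⇒nth (1 ∷ inner) (subst (suc y ∈_) coprimeList-≤N (∈-filter⁺ coprimeTo? (∈-map⁺ suc (∈-upTo⁺ y<N)) c))
      r = proj₁ position
      r<φ = proj₁ (proj₂ position)
      ur≡x = proj₂ (proj₂ position)

  open CoprimeEnumeration N (suc φ′) u G (u≡ 0) u-last u-increasing G-gap u-coprime u-complete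

  private
    windowSum≡ : ∀ i j → windowSum N i j ≡ U (i + j) ∸ U i
    windowSum≡ i j = trans (unfold φ′ phiLen≡) (trans (sum-map-upTo _ j) (windowSum-telescopes i j))
      where
      unfold : ∀ m → phiLen N ≡ suc m → windowSum N i j ≡ sum (map (λ t → G ((i + t) % suc m)) (upTo j))
      unfold m e with phiLen N | e
      ... | .(suc m) | refl = refl

    nCount≡ : ∀ g j → nCount g j N ≡ ∑[ i < suc φ′ ] 𝟙 (U (i + j) ∸ U i ≟ g)
    nCount≡ g j = begin
      nCount g j N                              ≡⟨ length-filter-upTo (λ i → windowSum N i j ≟ g) (phiLen N) ⟩
      ∑[ i < phiLen N ] 𝟙 (windowSum N i j ≟ g) ≡⟨ cong (λ n → ∑[ i < n ] 𝟙 (windowSum N i j ≟ g)) phiLen≡ ⟩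
      ∑[ i < suc φ′ ] 𝟙 (windowSum N i j ≟ g)   ≡⟨ ∑-cong (suc φ′) (λ i _ → 𝟙-cong _ _ (trans (sym (windowSum≡ i j))) (trans (windowSum≡ i j))) ⟩
      ∑[ i < suc φ′ ] 𝟙 (U (i + j) ∸ U i ≟ g)   ∎
      where open ≡-Reasoning

    -- Summing over the coprime residues u i ∈ [1, N] instead of all residues r ∈ [0, N); the two
    -- ranges differ only in 0 versus N, where the summand takes the same value.
    ∑-positions : ∀ g → ∑[ i < suc φ′ ] 𝟙 (coprime? (u i + g) N) ≡ coprimePairCount N g
    ∑-positions g = begin
      ∑[ i < suc φ′ ] h (u i)                            ≡⟨ ∑-cong (suc φ′) (λ i i<φ → cong h (trans (u≡ i) (nth-++ˡ (1 ∷ inner) [ suc N ] i<φ))) ⟩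
      ∑[ i < length (1 ∷ inner) ] h (nth (1 ∷ inner) i)  ≡⟨ ∑-nth h (1 ∷ inner) ⟩
      sum (map h (1 ∷ inner))                            ≡⟨ cong (λ xs → sum (map h xs)) coprimeList-≤N ⟨
      sum (map h (filter coprimeTo? (map suc (upTo N)))) ≡⟨ sum-map-filter coprimeTo? h (map suc (upTo N)) ⟩
      sum (map F (map suc (upTo N)))                     ≡⟨ cong sum (map-∘ (upTo N)) ⟨
      sum (map (λ t → F (suc t)) (upTo N))               ≡⟨ sum-map-upTo (λ t → F (suc t)) N ⟩
      ∑[ t < N ] F (suc t)                               ≡⟨ +-cancelʳ-≡ (F 0) _ _ (trans (∑-shift N F) (cong (_+_ (∑< N F)) F-periodic)) ⟩
      coprimePairCount N g                               ∎
      where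
      open ≡-Reasoning
      h : ℕ → ℕ
      h x = 𝟙 (coprime? (x + g) N)
      F : ℕ → ℕ
      F t = 𝟙 (coprime? t N) * 𝟙 (coprime? (t + g) N)
      F-periodic : F N ≡ F 0
      F-periodic = cong₂ _*_ (trans (cong (λ z → 𝟙 (coprime? z N)) (sym (trans (+-identityʳ (N * 1)) (*-identityʳ N)))) (𝟙-coprime-*+ 0 N 1))
                             (trans (cong (λ z → 𝟙 (coprime? (z + g) N)) (sym (*-identityʳ N))) (𝟙-coprime-*+ g N 1))

  ∑-nCount : ∀ g .{{_ : NonZero g}} → ∑[ j < g ] nCount g (suc j) N ≡ coprimePairCount N g
  ∑-nCount g = begin
    ∑[ j < g ] nCount g (suc j) N                          ≡⟨ ∑-cong g (λ j _ → nCount≡ g (suc j)) ⟩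
    ∑[ j < g ] ∑[ i < suc φ′ ] 𝟙 (U (i + suc j) ∸ U i ≟ g) ≡⟨ ∑-comm (suc φ′) g (λ i j → 𝟙 (U (i + suc j) ∸ U i ≟ g)) ⟨
    ∑[ i < suc φ′ ] ∑[ j < g ] 𝟙 (U (i + suc j) ∸ U i ≟ g) ≡⟨ ∑-cong (suc φ′) (λ i i<φ → windowCount i g i<φ) ⟩
    ∑[ i < suc φ′ ] 𝟙 (coprime? (u i + g) N)               ≡⟨ ∑-positions g ⟩
    coprimePairCount N g                                   ∎
    where open ≡-Reasoning

  nCount-2-1 : 2 ∣ N → nCount 2 1 N ≡ coprimePairCount N 2
  nCount-2-1 2∣N = begin
    nCount 2 1 N                ≡⟨ +-identityʳ _ ⟨
    nCount 2 1 N + 0            ≡⟨ cong (_+_ (nCount 2 1 N)) nCount-2-2 ⟨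
    nCount 2 1 N + nCount 2 2 N ≡⟨ ∑-nCount 2 ⟩
    coprimePairCount N 2        ∎
    where
    open ≡-Reasoning
    nCount-2-2 : nCount 2 2 N ≡ 0
    nCount-2-2 = trans (nCount≡ 2 2) (count-none (λ i → U (i + 2) ∸ U i ≟ 2) (suc φ′) (window₂≢2 2∣N))

∑-nCount : ∀ N .{{_ : NonZero N}} g .{{_ : NonZero g}} → ∑[ j < g ] nCount g (suc j) N ≡ coprimePairCount N g
∑-nCount (suc N₀) = GapSequence.∑-nCount N₀

nCount-2-1 : ∀ N .{{_ : NonZero N}} → 2 ∣ N → nCount 2 1 N ≡ coprimePairCount N 2
nCount-2-1 (suc N₀) = GapSequence.nCount-2-1 N₀

-- Rational bookkeeping

private
  toℚᵘ-/ : ∀ a b → toℚᵘ (+ a / suc b) ℚᵘ.≃ ℚᵘ.mkℚᵘ (+ a) b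
  toℚᵘ-/ a b = toℚᵘ-fromℚᵘ (ℚᵘ.mkℚᵘ (+ a) b)

+/-*-+/ : ∀ a b c d .{{_ : NonZero b}} .{{_ : NonZero d}} →
          (+ a / b) *ℚ (+ c / d) ≡ _/_ (+ (a * c)) (b * d) {{m*n≢0 b d}}
+/-*-+/ a (suc b) c (suc d) = toℚᵘ-injective (begin
  toℚᵘ ((+ a / suc b) *ℚ (+ c / suc d))      ≈⟨ toℚᵘ-homo-* (+ a / suc b) (+ c / suc d) ⟩
  toℚᵘ (+ a / suc b) ℚᵘ.* toℚᵘ (+ c / suc d) ≈⟨ ℚᵘ.*-cong (toℚᵘ-/ a b) (toℚᵘ-/ c d) ⟩
  ℚᵘ.mkℚᵘ (+ a ℤ.* + c) (d + b * suc d)      ≡⟨ cong (λ z → ℚᵘ.mkℚᵘ z _) (ℤ.pos-* a c) ⟨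
  ℚᵘ.mkℚᵘ (+ (a * c)) (d + b * suc d)        ≈⟨ ℚᵘ.≃-sym (toℚᵘ-/ (a * c) (d + b * suc d)) ⟩
  toℚᵘ (+ (a * c) / (suc b * suc d))         ∎)
  where open ℚᵘ.≃-Reasoning

private
  ℤ-cross-+ : ∀ a c D → (+ a ℤ.* + D ℤ.+ + c ℤ.* + D) ℤ.* + D ≡ + (a + c) ℤ.* + (D * D)
  ℤ-cross-+ a c D = begin
    (+ a ℤ.* + D ℤ.+ + c ℤ.* + D) ℤ.* + D ≡⟨ cong (ℤ._* + D) (cong₂ ℤ._+_ (ℤ.pos-* a D) (ℤ.pos-* c D)) ⟨
    (+ (a * D) ℤ.+ + (c * D)) ℤ.* + D     ≡⟨ cong (ℤ._* + D) (ℤ.pos-+ (a * D) (c * D)) ⟨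
    + (a * D + c * D) ℤ.* + D             ≡⟨ ℤ.pos-* (a * D + c * D) D ⟨
    + ((a * D + c * D) * D)               ≡⟨ cong +_ (solve 3 (λ a c D → (a :* D :+ c :* D) :* D := (a :+ c) :* (D :* D)) refl a c D) ⟩
    + ((a + c) * (D * D))                 ≡⟨ ℤ.pos-* (a + c) (D * D) ⟩
    + (a + c) ℤ.* + (D * D)               ∎
    where open ≡-Reasoning

+/-+-+/ : ∀ a c d .{{_ : NonZero d}} → (+ a / d) +ℚ (+ c / d) ≡ + (a + c) / d
+/-+-+/ a c (suc d) = toℚᵘ-injective (begin
  toℚᵘ ((+ a / D) +ℚ (+ c / D))                     ≈⟨ toℚᵘ-homo-+ (+ a / D) (+ c / D) ⟩
  toℚᵘ (+ a / D) ℚᵘ.+ toℚᵘ (+ c / D)                ≈⟨ ℚᵘ.+-cong (toℚᵘ-/ a d) (toℚᵘ-/ c d) ⟩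
  ℚᵘ.mkℚᵘ (+ a ℤ.* + D ℤ.+ + c ℤ.* + D) (d + d * D) ≈⟨ ℚᵘ.*≡* (ℤ-cross-+ a c D) ⟩
  ℚᵘ.mkℚᵘ (+ (a + c)) d                             ≈⟨ ℚᵘ.≃-sym (toℚᵘ-/ (a + c) d) ⟩
  toℚᵘ (+ (a + c) / D)                              ∎)
  where
  open ℚᵘ.≃-Reasoning
  D = suc d

n/n≡1 : ∀ n .{{_ : NonZero n}} → + n / n ≡ 1ℚ
n/n≡1 (suc n) = toℚᵘ-injective (ℚᵘ.≃-trans (toℚᵘ-/ (suc n) n) (ℚᵘ.*≡* (trans (ℤ.*-identityʳ (+ suc n)) (sym (ℤ.*-identityˡ (+ suc n))))))

sumℚ-+/ : ∀ (h : ℕ → ℕ) d .{{_ : NonZero d}} xs → sumℚ (map (λ x → + h x / d) xs) ≡ + sum (map h xs) / d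
sumℚ-+/ h d []       = sym (0/n≡0 d)
sumℚ-+/ h d (x ∷ xs) = trans (cong ((+ h x / d) +ℚ_) (sumℚ-+/ h d xs)) (+/-+-+/ (h x) (sum (map h xs)) d)

prodℚ-++ : ∀ xs ys → prodℚ (xs ++ ys) ≡ prodℚ xs *ℚ prodℚ ys
prodℚ-++ []       ys = sym (ℚ.*-identityˡ _)
prodℚ-++ (x ∷ xs) ys = trans (cong (x *ℚ_) (prodℚ-++ xs ys)) (sym (ℚ.*-assoc x _ _))

private
  -- Generalising nCount g j N to x keeps it out of the goal: abstracting nCount 2 1 N would
  -- otherwise compare the two by unfolding nCount, which evaluates the coprime list of N.
  w-unfold : ∀ g j N d x → x ≡ nCount g j N → nCount 2 1 N ≡ suc d → w g j N ≡ + x / suc d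
  w-unfold g j N d x x≡ e with nCount 2 1 N | e
  ... | _ | refl = cong (λ n → + n / suc d) (sym x≡)

w≡ : ∀ g j N d .{{_ : NonZero d}} → nCount 2 1 N ≡ d → w g j N ≡ + nCount g j N / d
w≡ g j N (suc d) = w-unfold g j N d (nCount g j N) refl

sumW≡ : ∀ g .{{_ : NonZero g}} N d .{{_ : NonZero d}} → nCount 2 1 N ≡ d →
        sumW g N ≡ + (∑[ j < g ] nCount g (suc j) N) / d
sumW≡ (suc g′) N d e = begin
  sumℚ (map (λ j → w g j N) (map suc (upTo g)))        ≡⟨ cong sumℚ (map-∘ {g = λ j → w g j N} {f = suc} (upTo g)) ⟨
  sumℚ (map (λ t → w g (suc t) N) (upTo g))            ≡⟨ cong sumℚ (map-cong (λ t → w≡ g (suc t) N d e) (upTo g)) ⟩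
  sumℚ (map (λ t → + nCount g (suc t) N / d) (upTo g)) ≡⟨ sumℚ-+/ (λ t → nCount g (suc t) N) d (upTo g) ⟩
  + sum (map (λ t → nCount g (suc t) N) (upTo g)) / d  ≡⟨ cong (λ n → + n / d) (sum-map-upTo (λ t → nCount g (suc t) N) g) ⟩
  + (∑[ j < g ] nCount g (suc j) N) / d                ∎
  where
  open ≡-Reasoning
  g = suc g′

sieveRatio : ℕ → ℕ → ℚ
sieveRatio g m = _/_ (+ sieveProduct g m) (sieveProduct 2 m) {{sieveProduct-2-nonZero m}}

factor-¬prime : ∀ g q → ¬ Prime q → factor g q ≡ 1ℚ
factor-¬prime g q ¬p with prime? q
... | yes p = ⊥-elim (¬p p)
factor-¬prime g 0                 ¬p | no _ = refl
factor-¬prime g 1                 ¬p | no _ = refl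
factor-¬prime g 2                 ¬p | no _ = refl
factor-¬prime g (suc (suc (suc r))) ¬p | no _ = refl

private
  𝟙-3+r∣?2 : ∀ r → 𝟙 (suc (suc (suc r)) ∣? 2) ≡ 0
  𝟙-3+r∣?2 r with suc (suc (suc r)) ∣? 2
  ... | no _  = refl
  ... | yes d with ∣⇒≤ d
  ...   | s≤s (s≤s ())

factor-prime : ∀ g q → 2 ∣ g → (p : Prime q) → factor g q ≡ _/_ (+ localFactor q g) (localFactor q 2) {{localFactor-2-nonZero p}}
factor-prime g 0 _ p = ⊥-elim (¬prime[0] p)
factor-prime g 1 _ p = ⊥-elim (¬prime[1] p)
factor-prime g 2 2∣g p with 2 ∣? g
... | yes _   = refl
... | no 2∤g  = ⊥-elim (2∤g 2∣g)
factor-prime g (suc (suc (suc r))) 2∣g p with prime? (suc (suc (suc r))) | suc (suc (suc r)) ∣? g | 2 <? suc (suc (suc r))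
... | no ¬p | _     | _     = ⊥-elim (¬p p)
... | yes _ | _     | no ¬q = ⊥-elim (¬q (s≤s (s≤s (s≤s z≤n))))
... | yes _ | yes _ | yes _ = /-cong (cong +_ (+-comm 1 (suc r))) (sym (trans (cong (_+_ (suc r)) (𝟙-3+r∣?2 r)) (+-comm (suc r) 0)))
... | yes _ | no _  | yes _ = trans (sym (n/n≡1 (suc r + 0))) (/-cong {p₁ = + (suc r + 0)} refl (cong (_+_ (suc r)) (sym (𝟙-3+r∣?2 r))))

sieveRatio-suc : ∀ g → 2 ∣ g → ∀ m → sieveRatio g m *ℚ factor g (suc m) ≡ sieveRatio g (suc m)
sieveRatio-suc g 2∣g m = by-primality (prime? (suc m))
  where
  open ≡-Reasoning
  D≢0  = sieveProduct-2-nonZero m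
  D′≢0 = sieveProduct-2-nonZero (suc m)
  by-primality : Dec (Prime (suc m)) → sieveRatio g m *ℚ factor g (suc m) ≡ sieveRatio g (suc m)
  by-primality (yes p) = begin
    sieveRatio g m *ℚ factor g (suc m)
      ≡⟨ cong (sieveRatio g m *ℚ_) (factor-prime g (suc m) 2∣g p) ⟩
    sieveRatio g m *ℚ _/_ (+ localFactor (suc m) g) (localFactor (suc m) 2) {{L≢0}}
      ≡⟨ +/-*-+/ (sieveProduct g m) (sieveProduct 2 m) (localFactor (suc m) g) (localFactor (suc m) 2) {{D≢0}} {{L≢0}} ⟩
    _/_ (+ (sieveProduct g m * localFactor (suc m) g)) (sieveProduct 2 m * localFactor (suc m) 2) {{DL≢0}}
      ≡⟨ /-cong {{DL≢0}} {{D′≢0}} (cong +_ (sym (sieveProduct-suc-prime g m p))) (sym (sieveProduct-suc-prime 2 m p)) ⟩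
    sieveRatio g (suc m) ∎
    where
    L≢0  = localFactor-2-nonZero p
    DL≢0 = m*n≢0 (sieveProduct 2 m) (localFactor (suc m) 2) {{D≢0}} {{L≢0}}
  by-primality (no ¬p) = begin
    sieveRatio g m *ℚ factor g (suc m) ≡⟨ cong (sieveRatio g m *ℚ_) (factor-¬prime g (suc m) ¬p) ⟩
    sieveRatio g m *ℚ 1ℚ               ≡⟨ ℚ.*-identityʳ (sieveRatio g m) ⟩
    sieveRatio g m                     ≡⟨ /-cong {{D≢0}} {{D′≢0}} (cong +_ (sym (sieveProduct-suc-¬prime g m ¬p)))
                                                                (sym (sieveProduct-suc-¬prime 2 m ¬p)) ⟩
    sieveRatio g (suc m)               ∎

prodℚ-factor : ∀ g → 2 ∣ g → ∀ m → prodℚ (map (factor g) (map suc (upTo m))) ≡ sieveRatio g m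
prodℚ-factor g 2∣g zero    = refl
prodℚ-factor g 2∣g (suc m) = begin
  prodℚ (map (factor g) (map suc (upTo (suc m))))                       ≡⟨ cong (λ xs → prodℚ (map (factor g) (map suc xs))) (upTo-∷ʳ m) ⟨
  prodℚ (map (factor g) (map suc (upTo m ++ [ m ])))                    ≡⟨ cong (λ xs → prodℚ (map (factor g) xs)) (map-++ suc (upTo m) [ m ]) ⟩
  prodℚ (map (factor g) (map suc (upTo m) ++ [ suc m ]))                ≡⟨ cong prodℚ (map-++ (factor g) (map suc (upTo m)) [ suc m ]) ⟩
  prodℚ (map (factor g) (map suc (upTo m)) ++ [ factor g (suc m) ])     ≡⟨ prodℚ-++ (map (factor g) (map suc (upTo m))) [ factor g (suc m) ] ⟩
  prodℚ (map (factor g) (map suc (upTo m))) *ℚ (factor g (suc m) *ℚ 1ℚ) ≡⟨ cong₂ _*ℚ_ (prodℚ-factor g 2∣g m) (ℚ.*-identityʳ (factor g (suc m))) ⟩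
  sieveRatio g m *ℚ factor g (suc m)                                    ≡⟨ sieveRatio-suc g 2∣g m ⟩
  sieveRatio g (suc m)                                                  ∎
  where open ≡-Reasoning

mainTheorem12 : (n : ℕ) → 1 ≤ n → (p : ℕ) → Prime p →
    sumW (2 * n) (primorial p) ≡ prodFactor (2 * n) p
mainTheorem12 zero    ()
mainTheorem12 (suc n) _ zero      pp = ⊥-elim (¬prime[0] pp)
mainTheorem12 (suc n) _ p@(suc _) pp = begin
  sumW g N                                          ≡⟨ sumW≡ g N D {{D≢0}} nCount-2-1≡D ⟩
  _/_ (+ (∑[ j < g ] nCount g (suc j) N)) D {{D≢0}} ≡⟨ cong (λ x → _/_ (+ x) D {{D≢0}}) ∑nCount≡ ⟩
  sieveRatio g p                                    ≡⟨ prodℚ-factor g (divides (suc n) (*-comm 2 (suc n))) p ⟨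
  prodFactor g p                                    ∎
  where
  open ≡-Reasoning
  N = primorial p
  g = 2 * suc n
  D = sieveProduct 2 p
  D≢0 = sieveProduct-2-nonZero p
  ∑nCount≡ : ∑[ j < g ] nCount g (suc j) N ≡ sieveProduct g p
  ∑nCount≡ = trans (∑-nCount N {{primorial-nonZero p}} g) (coprimePairCount-primorial g p)
  nCount-2-1≡D : nCount 2 1 N ≡ D
  nCount-2-1≡D = trans (nCount-2-1 N {{primorial-nonZero p}} (2∣primorial pp)) (coprimePairCount-primorial 2 p)
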